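{- Let $F = \sum_{n \geq n_0} a_{n} q^n \in \mathcal{QM}_{w}^{s}$ be completely positive. For every $k \geq 0$ and every $n \geq k / 12$, the $n$-th Fourier coefficient (coefficient of $q^n$) of $\partial_{k}F$ is nonnegative. In particular, if $n_0 \geq k / 12 \geq 0$, then $\partial_k F$ is also completely positive.
   Context: Quasimodular forms for $\mathrm{SL}_2(\mathbb{Z})$ form the polynomial ring $\mathbb{C}[E_2,E_4,E_6]$ in the Eisenstein series $E_2 = 1 - 24\sum_{n\ge1}\sigma_1(n)q^n$, $E_4 = 1+240\sum_{n\ge1}\sigma_3(n)q^n$, $E_6 = 1-504\sum_{n\ge1}\sigma_5(n)q^n$ ($q=e^{2\pi i z}$, $\sigma_a(n)=\sum_{d\mid n}d^a$), graded by weight, with depth equal to the degree in $E_2$; $\mathcal{QM}_w^s$ is the space of those of weight $w$ and depth $\le s$. $F' = q\frac{dF}{dq}$ and $\partial_k F := F' - \frac{k}{12}E_2F$. $F$ is completely positive if all its Fourier coefficients are real and nonnegative. -}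

module Defs where

open import Level using (0ℓ)
open import Data.Nat as ℕ using (ℕ; zero; suc)
open import Data.Nat.Divisibility using (_∣?_)
open import Data.Integer as ℤ using (ℤ; +_; -[1+_])
open import Data.List using (List; []; _∷_; map; upTo)
open import Data.Nat.ListAction using (sum)
open import Data.List.Relation.Unary.All using (All)
open import Data.Product using (Σ; ∃; _×_; _,_)
open import Data.Bool using (if_then_else_)
open import Relation.Nullary using (¬_; does)
open import Relation.Binary.PropositionalEquality using (_≡_)
open import Relation.Binary.Structures using (IsTotalOrder)
open import Algebra.Structures using (IsCommutativeRing)

-- An axiomatization of the real numbers: a complete ordered field.
-- (Any two such structures are isomorphic, so this pins down ℝ.)

record RealField : Set₁ where
  infixl 6 _+_ _-_
  infixl 7 _*_
  infix 4 _≤_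
  field
    Carrier : Set
    _+_ _*_ : Carrier → Carrier → Carrier
    -_      : Carrier → Carrier
    0# 1#   : Carrier
    inv     : Carrier → Carrier
    _≤_     : Carrier → Carrier → Set
    isCommutativeRing : IsCommutativeRing _≡_ _+_ _*_ -_ 0# 1#
    0≢1     : ¬ (0# ≡ 1#)
    inv-r   : ∀ x → ¬ (x ≡ 0#) → x * inv x ≡ 1#
    isTotalOrder : IsTotalOrder _≡_ _≤_
    +-mono-≤  : ∀ {x y} z → x ≤ y → x + z ≤ y + z
    *-nonneg  : ∀ {x y} → 0# ≤ x → 0# ≤ y → 0# ≤ x * y
    complete  : (P : Carrier → Set) → Σ Carrier P →
                Σ Carrier (λ u → ∀ x → P x → x ≤ u) →
                Σ Carrier (λ s → (∀ x → P x → x ≤ s) ×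
                                 (∀ u → (∀ x → P x → x ≤ u) → s ≤ u))

  _-_ : Carrier → Carrier → Carrier
  x - y = x + (- y)

  fromℕ : ℕ → Carrier
  fromℕ zero    = 0#
  fromℕ (suc n) = 1# + fromℕ n

  fromℤ : ℤ → Carrier
  fromℤ (+ n)      = fromℕ n
  fromℤ -[1+ n ]   = - fromℕ (suc n)

  sumL : List Carrier → Carrier
  sumL []       = 0#
  sumL (x ∷ xs) = x + sumL xs

σ : ℕ → ℕ → ℕ
σ a n = sum (map (λ d → if does (d ∣? n) then d ℕ.^ a else 0)
                           (map suc (upTo n)))

module _ (R : RealField) where
  open RealField R

  -- q-series with real coefficients (power series in q: n ↦ coeff of q^n)
  Series : Set
  Series = ℕ → Carrier

  _⊛_ : Series → Series → Series
  (f ⊛ g) n = sumL (map (λ i → f i * g (n ℕ.∸ i)) (upTo (suc n)))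

  oneS : Series
  oneS zero    = 1#
  oneS (suc _) = 0#

  _^S_ : Series → ℕ → Series
  f ^S zero  = oneS
  f ^S suc m = f ⊛ (f ^S m)

  E₂ E₄ E₆ : Series
  E₂ zero = 1#
  E₂ (suc n) = fromℤ (ℤ.- (+ 24)) * fromℕ (σ 1 (suc n))
  E₄ zero = 1#
  E₄ (suc n) = fromℕ 240 * fromℕ (σ 3 (suc n))
  E₆ zero = 1#
  E₆ (suc n) = fromℤ (ℤ.- (+ 504)) * fromℕ (σ 5 (suc n))

  record ℂSeries : Set where
    constructor mkℂS
    field
      re im : Series

  -- a monomial  (c_re + i c_im) E₂^e₂ E₄^e₄ E₆^e₆  with complex coefficient
  record Monomial : Set where
    constructor mono
    field
      cre cim  : Carrier
      e₂ e₄ e₆ : ℕ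

  Poly : Set
  Poly = List Monomial

  monoSeries : Monomial → Series
  monoSeries m = ((E₂ ^S e₂) ⊛ (E₄ ^S e₄)) ⊛ (E₆ ^S e₆)
    where open Monomial m

  qexp : Poly → ℂSeries
  qexp P = mkℂS (λ n → sumL (map (λ m → Monomial.cre m * monoSeries m n) P))
                (λ n → sumL (map (λ m → Monomial.cim m * monoSeries m n) P))

  -- P represents an element of QM_w^s: every monomial has weight w
  -- (E₂,E₄,E₆ of weights 2,4,6) and E₂-degree ≤ s
  InQM : ℕ → ℕ → Poly → Set
  InQM w s P = All (λ m → (2 ℕ.* Monomial.e₂ m ℕ.+ 4 ℕ.* Monomial.e₄ m
                            ℕ.+ 6 ℕ.* Monomial.e₆ m ≡ w)
                          × Monomial.e₂ m ℕ.≤ s) P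

  NonNegℂ : Carrier → Carrier → Set
  NonNegℂ x y = (y ≡ 0#) × (0# ≤ x)

  CoeffNonNeg : ℂSeries → ℕ → Set
  CoeffNonNeg F n = NonNegℂ (ℂSeries.re F n) (ℂSeries.im F n)

  CompletelyPositive : ℂSeries → Set
  CompletelyPositive F = ∀ n → CoeffNonNeg F n

  -- F' = q dF/dq
  derivS : Series → Series
  derivS f n = fromℕ n * f n

  serreS : Carrier → Series → Series
  serreS k f n = derivS f n - (k * inv (fromℕ 12)) * (E₂ ⊛ f) n

  serre : Carrier → ℂSeries → ℂSeries
  serre k F = mkℂS (serreS k (ℂSeries.re F)) (serreS k (ℂSeries.im F))

-- Write c = k/12 and a_m for the m-th coefficient of F. Since E₂ = 1 - 24 Σ σ₁(j) q^j,
--   (∂_k F)_n = (n - c) a_n + 24 c Σ_{1 ≤ j ≤ n} σ₁(j) a_{n-j},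
-- and both terms are nonnegative once n ≥ c ≥ 0 and all a_m ≥ 0. Below n₀ all the
-- coefficients involved vanish, so those coefficients of ∂_k F vanish as well.
module Submission where

open import Defs
open import Level using (0ℓ)
open import Data.Nat as ℕ using (ℕ; zero; suc; _∸_; _<_; z≤n; s≤s)
open import Data.Nat.Properties using (≤-<-trans; m∸n≤m; _<?_; ≮⇒≥) renaming (≤-refl to ℕ≤-refl)
open import Data.List using (List; map; applyUpTo)
open import Data.List.Relation.Unary.All using (All; _∷_; [])
open import Data.List.Relation.Unary.All.Properties using (map⁺; applyUpTo⁺₂)
open import Data.Product using (_×_; _,_; proj₁; proj₂)
open import Data.Sum using (_⊎_; inj₁; inj₂)
open import Relation.Nullary using (¬_; yes; no; contradiction)
open import Relation.Binary.PropositionalEquality using (_≡_; refl; sym; trans; cong; cong₂; subst; module ≡-Reasoning)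
open import Relation.Binary.Bundles using (Poset)
open import Relation.Binary.Structures using (IsTotalOrder)
open import Algebra.Bundles using (Ring; CommutativeRing)
import Algebra.Properties.Ring as RingProperties
import Relation.Binary.Reasoning.Setoid as SetoidReasoning
import Relation.Binary.Reasoning.PartialOrder as PosetReasoning

module _ {c ℓ} (R : Ring c ℓ) where
  open Ring R
  open RingProperties R using (-‿distribˡ-*; -‿distribʳ-*; -‿+-comm)
  open SetoidReasoning setoid

  ax-b[1x+t]≈[a-b]x+b[-t] : ∀ a b x t → a * x - b * (1# * x + t) ≈ (a - b) * x + b * - t
  ax-b[1x+t]≈[a-b]x+b[-t] a b x t = begin
    a * x - b * (1# * x + t)            ≈⟨ +-congˡ (-‿cong (*-congˡ (+-congʳ (*-identityˡ x)))) ⟩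
    a * x + - (b * (x + t))             ≈⟨ +-congˡ (-‿cong (distribˡ b x t)) ⟩
    a * x + - (b * x + b * t)           ≈⟨ +-congˡ (-‿+-comm (b * x) (b * t)) ⟨
    a * x + (- (b * x) + - (b * t))     ≈⟨ +-congˡ (+-cong (-‿distribˡ-* b x) (-‿distribʳ-* b t)) ⟩
    a * x + (- b * x + b * - t)         ≈⟨ +-assoc (a * x) (- b * x) (b * - t) ⟨
    a * x + - b * x + b * - t           ≈⟨ +-congʳ (distribʳ x a (- b)) ⟨
    (a - b) * x + b * - t               ∎

module RealFieldProperties (R : RealField) where
  open RealField R

  commutativeRing : CommutativeRing 0ℓ 0ℓ
  commutativeRing = record { isCommutativeRing = isCommutativeRing }

  open CommutativeRing commutativeRing public
    using (ring; +-comm; +-identityˡ; +-identityʳ; -‿inverseʳ; zeroʳ)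
  open RingProperties ring using (-‿distribˡ-*; -‿distribʳ-*; -‿involutive; -1*x≈-x)

  poset : Poset 0ℓ 0ℓ 0ℓ
  poset = record { isPartialOrder = IsTotalOrder.isPartialOrder isTotalOrder }

  open Poset poset public using ()
    renaming (refl to ≤-refl; trans to ≤-trans; reflexive to ≤-reflexive; antisym to ≤-antisym)
  open PosetReasoning poset

  ≤-total : ∀ x y → x ≤ y ⊎ y ≤ x
  ≤-total = IsTotalOrder.total isTotalOrder

  +-monoʳ-≤ : ∀ {x y} z → x ≤ y → z + x ≤ z + y
  +-monoʳ-≤ {x} {y} z x≤y = begin
    z + x ≡⟨ +-comm z x ⟩
    x + z ≤⟨ +-mono-≤ z x≤y ⟩
    y + z ≡⟨ +-comm y z ⟩
    z + y ∎

  +-nonneg : ∀ {x y} → 0# ≤ x → 0# ≤ y → 0# ≤ x + y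
  +-nonneg {x} {y} 0≤x 0≤y = begin
    0#     ≡⟨ +-identityˡ 0# ⟨
    0# + 0# ≤⟨ +-mono-≤ 0# 0≤x ⟩
    x + 0# ≤⟨ +-monoʳ-≤ x 0≤y ⟩
    x + y  ∎

  x≤y⇒0≤y-x : ∀ {x y} → x ≤ y → 0# ≤ y - x
  x≤y⇒0≤y-x {x} {y} x≤y = begin
    0#     ≡⟨ -‿inverseʳ x ⟨
    x - x  ≤⟨ +-mono-≤ (- x) x≤y ⟩
    y - x  ∎

  x≤0⇒0≤-x : ∀ {x} → x ≤ 0# → 0# ≤ - x
  x≤0⇒0≤-x {x} x≤0 = subst (0# ≤_) (+-identityˡ (- x)) (x≤y⇒0≤y-x x≤0)

  0≤-x⇒x≤0 : ∀ {x} → 0# ≤ - x → x ≤ 0#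
  0≤-x⇒x≤0 {x} 0≤-x = begin
    x       ≡⟨ +-identityʳ x ⟨
    x + 0#  ≤⟨ +-monoʳ-≤ x 0≤-x ⟩
    x - x   ≡⟨ -‿inverseʳ x ⟩
    0#      ∎

  0≤x⇒-x≤0 : ∀ {x} → 0# ≤ x → - x ≤ 0#
  0≤x⇒-x≤0 {x} 0≤x = begin
    - x      ≡⟨ +-identityˡ (- x) ⟨
    0# - x   ≤⟨ +-mono-≤ (- x) 0≤x ⟩
    x - x    ≡⟨ -‿inverseʳ x ⟩
    0#       ∎

  +-nonpos : ∀ {x y} → x ≤ 0# → y ≤ 0# → x + y ≤ 0#
  +-nonpos {x} {y} x≤0 y≤0 = begin
    x + y   ≤⟨ +-mono-≤ y x≤0 ⟩
    0# + y  ≡⟨ +-identityˡ y ⟩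
    y       ≤⟨ y≤0 ⟩
    0#      ∎

  *-nonpos-nonneg : ∀ {x y} → x ≤ 0# → 0# ≤ y → x * y ≤ 0#
  *-nonpos-nonneg {x} {y} x≤0 0≤y =
    0≤-x⇒x≤0 (subst (0# ≤_) (sym (-‿distribˡ-* x y)) (*-nonneg (x≤0⇒0≤-x x≤0) 0≤y))

  -- If 1 ≤ 0 then 0 ≤ (-1) * (-1) = 1.
  0≤1 : 0# ≤ 1#
  0≤1 with ≤-total 0# 1#
  ... | inj₁ 0≤1 = 0≤1
  ... | inj₂ 1≤0 = subst (0# ≤_) -1*-1≡1 (*-nonneg (x≤0⇒0≤-x 1≤0) (x≤0⇒0≤-x 1≤0))
    where
    -1*-1≡1 : - 1# * - 1# ≡ 1#
    -1*-1≡1 = trans (-1*x≈-x (- 1#)) (-‿involutive 1#)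

  1≰0 : ¬ 1# ≤ 0#
  1≰0 1≤0 = 0≢1 (≤-antisym 0≤1 1≤0)

  fromℕ-nonneg : ∀ n → 0# ≤ fromℕ n
  fromℕ-nonneg zero    = ≤-refl
  fromℕ-nonneg (suc n) = +-nonneg 0≤1 (fromℕ-nonneg n)

  fromℕ-mono-≤ : ∀ {m n} → m ℕ.≤ n → fromℕ m ≤ fromℕ n
  fromℕ-mono-≤ {n = n} z≤n = fromℕ-nonneg n
  fromℕ-mono-≤ (s≤s m≤n)   = +-monoʳ-≤ 1# (fromℕ-mono-≤ m≤n)

  fromℕ-suc≢0 : ∀ n → ¬ fromℕ (suc n) ≡ 0#
  fromℕ-suc≢0 n 1+n≡0 = 1≰0 (begin
    1#            ≡⟨ +-identityʳ 1# ⟨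
    1# + 0#       ≤⟨ +-monoʳ-≤ 1# (fromℕ-nonneg n) ⟩
    fromℕ (suc n) ≡⟨ 1+n≡0 ⟩
    0#            ∎)

  -- If inv x ≤ 0 then 0 ≤ x * (- inv x) = -1.
  inv-nonneg : ∀ {x} → 0# ≤ x → ¬ x ≡ 0# → 0# ≤ inv x
  inv-nonneg {x} 0≤x x≢0 with ≤-total 0# (inv x)
  ... | inj₁ 0≤inv = 0≤inv
  ... | inj₂ inv≤0 = contradiction (0≤-x⇒x≤0 0≤-1) 1≰0
    where
    0≤-1 : 0# ≤ - 1#
    0≤-1 = subst (0# ≤_) (trans (sym (-‿distribʳ-* x (inv x))) (cong -_ (inv-r x x≢0)))
                 (*-nonneg 0≤x (x≤0⇒0≤-x inv≤0))

  sumL-closed : (P : Carrier → Set) → P 0# → (∀ {x y} → P x → P y → P (x + y)) →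
                ∀ {xs} → All P xs → P (sumL xs)
  sumL-closed P P0 P+ []         = P0
  sumL-closed P P0 P+ (px ∷ pxs) = P+ px (sumL-closed P P0 P+ pxs)

module SerreCoefficients (R : RealField) where
  open RealField R
  open RealFieldProperties R
  open RingProperties ring using (-0#≈0#)

  E₂-suc-nonpos : ∀ j → E₂ R (suc j) ≤ 0#
  E₂-suc-nonpos j = *-nonpos-nonneg (0≤x⇒-x≤0 (fromℕ-nonneg 24)) (fromℕ-nonneg (σ 1 (suc j)))

  E₂-tail : Series R → ℕ → Carrier
  E₂-tail f n = sumL (map (λ i → E₂ R i * f (n ∸ i)) (applyUpTo suc n))

  E₂-tail-closed : (P : Carrier → Set) → P 0# → (∀ {x y} → P x → P y → P (x + y)) →
                   ∀ f n → (∀ j → P (E₂ R (suc j) * f (n ∸ suc j))) → P (E₂-tail f n)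
  E₂-tail-closed P P0 P+ f n Pj = sumL-closed P P0 P+ (map⁺ (applyUpTo⁺₂ suc n Pj))

  E₂-tail-nonpos : ∀ f n → (∀ m → 0# ≤ f m) → E₂-tail f n ≤ 0#
  E₂-tail-nonpos f n 0≤f = E₂-tail-closed (_≤ 0#) ≤-refl +-nonpos f n
    (λ j → *-nonpos-nonneg (E₂-suc-nonpos j) (0≤f (n ∸ suc j)))

  E₂-tail-vanishes : ∀ f n → (∀ m → m ℕ.≤ n → f m ≡ 0#) → E₂-tail f n ≡ 0#
  E₂-tail-vanishes f n f≡0 = E₂-tail-closed (_≡ 0#) refl
    (λ x≡0 y≡0 → trans (cong₂ _+_ x≡0 y≡0) (+-identityʳ 0#)) f n
    (λ j → trans (cong (E₂ R (suc j) *_) (f≡0 (n ∸ suc j) (m∸n≤m n (suc j)))) (zeroʳ _))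

  -- Definitionally (E₂ ⊛ f) n = 1# * f n + E₂-tail f n, as E₂ 0 = 1.
  serreS-split : ∀ k f n → serreS R k f n ≡
    (fromℕ n - k * inv (fromℕ 12)) * f n + k * inv (fromℕ 12) * - E₂-tail f n
  serreS-split k f n = ax-b[1x+t]≈[a-b]x+b[-t] ring (fromℕ n) (k * inv (fromℕ 12)) (f n) (E₂-tail f n)

  serreS-nonneg : ∀ {k} f n → 0# ≤ k → (∀ m → 0# ≤ f m) →
                  k * inv (fromℕ 12) ≤ fromℕ n → 0# ≤ serreS R k f n
  serreS-nonneg {k} f n 0≤k 0≤f k/12≤n = subst (0# ≤_) (sym (serreS-split k f n))
    (+-nonneg (*-nonneg (x≤y⇒0≤y-x k/12≤n) (0≤f n))
              (*-nonneg 0≤k/12 (x≤0⇒0≤-x (E₂-tail-nonpos f n 0≤f))))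
    where
    0≤k/12 : 0# ≤ k * inv (fromℕ 12)
    0≤k/12 = *-nonneg 0≤k (inv-nonneg (fromℕ-nonneg 12) (fromℕ-suc≢0 11))

  serreS-vanishes : ∀ k f n → (∀ m → m ℕ.≤ n → f m ≡ 0#) → serreS R k f n ≡ 0#
  serreS-vanishes k f n f≡0 = begin
    serreS R k f n                       ≡⟨ serreS-split k f n ⟩
    (fromℕ n - c) * f n + c * - E₂-tail f n
      ≡⟨ cong₂ (λ a t → (fromℕ n - c) * a + c * - t) (f≡0 n ℕ≤-refl) (E₂-tail-vanishes f n f≡0) ⟩
    (fromℕ n - c) * 0# + c * - 0#        ≡⟨ cong (λ z → (fromℕ n - c) * 0# + c * z) -0#≈0# ⟩
    (fromℕ n - c) * 0# + c * 0#          ≡⟨ cong₂ _+_ (zeroʳ _) (zeroʳ c) ⟩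
    0# + 0#                              ≡⟨ +-identityʳ 0# ⟩
    0#                                   ∎
    where
    open ≡-Reasoning
    c = k * inv (fromℕ 12)

open SerreCoefficients

proposition3p8 : (R : RealField) → (w s : ℕ) → (P : List (Monomial R)) →
    InQM R w s P → CompletelyPositive R (qexp R P) →
    (k : RealField.Carrier R) → RealField._≤_ R (RealField.0# R) k →
    ((n : ℕ) → RealField._≤_ R (RealField._*_ R k (RealField.inv R (RealField.fromℕ R 12))) (RealField.fromℕ R n) →
      CoeffNonNeg R (serre R k (qexp R P)) n)
    × ((n₀ : ℕ) →
       ((n : ℕ) → n < n₀ → (ℂSeries.re (qexp R P) n ≡ RealField.0# R) × (ℂSeries.im (qexp R P) n ≡ RealField.0# R)) →
       RealField._≤_ R (RealField._*_ R k (RealField.inv R (RealField.fromℕ R 12))) (RealField.fromℕ R n₀) →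
       CompletelyPositive R (serre R k (qexp R P)))
proposition3p8 R w s P _ cp k 0≤k = coeffNonNeg , completelyPositive
  where
  open RealField R using (_*_; _≤_; 0#; inv; fromℕ)
  open RealFieldProperties R using (≤-reflexive; ≤-trans; fromℕ-mono-≤)
  F = qexp R P

  coeffNonNeg : ∀ n → k * inv (fromℕ 12) ≤ fromℕ n → CoeffNonNeg R (serre R k F) n
  coeffNonNeg n k/12≤n = serreS-vanishes R k (ℂSeries.im F) n (λ m _ → proj₁ (cp m))
                       , serreS-nonneg R (ℂSeries.re F) n 0≤k (λ m → proj₂ (cp m)) k/12≤n

  completelyPositive : ∀ n₀ → (∀ n → n < n₀ → (ℂSeries.re F n ≡ 0#) × (ℂSeries.im F n ≡ 0#)) →
                       k * inv (fromℕ 12) ≤ fromℕ n₀ → CompletelyPositive R (serre R k F)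
  completelyPositive n₀ F≡0 k/12≤n₀ n with n <? n₀
  ... | yes n<n₀ = serreS-vanishes R k (ℂSeries.im F) n (λ m m≤n → proj₂ (F≡0 m (below m≤n)))
                 , ≤-reflexive (sym re≡0)
    where
    below : ∀ {m} → m ℕ.≤ n → m < n₀
    below m≤n = ≤-<-trans m≤n n<n₀
    re≡0 : serreS R k (ℂSeries.re F) n ≡ 0#
    re≡0 = serreS-vanishes R k (ℂSeries.re F) n (λ m m≤n → proj₁ (F≡0 m (below m≤n)))
  ... | no n≮n₀ = coeffNonNeg n (≤-trans k/12≤n₀ (fromℕ-mono-≤ (≮⇒≥ n≮n₀)))
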